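{- Let $k \geq 2$ be an integer and let $G_0=(V,E)$ be a graph. Suppose $V = U \cup W$ is a partition such that $\nu(G_0)=\nu(G_0\setminus W)=k-1$. Suppose further that there are vertices $w_1,w_2 \in W$ and $u \in U$ with $d_{G_0}(w_1)=d_{G_0}(w_2)=1$ and $\{uw_1,uw_2\}\subseteq E$. Then Max, as the second player, has a strategy in the $(G_0,\mathcal{M}_k)$ game ensuring that at the end of the game every $w \in W$ has at least one neighbor in $U$ in the final graph.
   Context: $\nu(H)$ is the size of a maximum matching of $H$; $G_0\setminus W$ is the graph obtained by deleting the vertices of $W$. $\mathcal{M}_k$ is the property of admitting a matching of size $k$. For a graph $H$ with no matching of size $k$, the saturation game $(H,\mathcal{M}_k)$ is played as follows. Starting with $G=H$, two players, Mini and Max, alternately add to $G$ an edge $e\notin E(G)$ such that $G\cup\{e\}$ has no matching of size $k$. The game ends when no such edge exists. Max wants to maximize and Mini to minimize the final number of edges. -}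

module Defs where

open import Data.Nat using (ℕ; _<_; _+_)
open import Data.Fin using (Fin; _≟_)
open import Data.Fin.Properties using ()
open import Data.Bool using (Bool; true; false; _∧_; _∨_; not; T; if_then_else_)
open import Data.List using (List; map; allFin)
open import Data.Nat.ListAction using (sum)
open import Data.Product using (Σ; ∃; _×_; _,_; proj₁; proj₂)
open import Relation.Nullary using (¬_)
open import Relation.Nullary.Decidable using (⌊_⌋)
open import Relation.Binary.PropositionalEquality using (_≡_; _≢_)

Graph : ℕ → Set
Graph n = Fin n → Fin n → Bool

module _ {n : ℕ} where

  Adj : Graph n → Fin n → Fin n → Set
  Adj G x y = T (G x y)

  IsSimple : Graph n → Set
  IsSimple G = (∀ x y → G x y ≡ G y x) × (∀ x → G x x ≡ false)

  addEdge : Graph n → Fin n → Fin n → Graph n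
  addEdge G a b x y =
    G x y ∨ (⌊ x ≟ a ⌋ ∧ ⌊ y ≟ b ⌋) ∨ (⌊ x ≟ b ⌋ ∧ ⌊ y ≟ a ⌋)

  -- Realised by deleting all edges meeting W; the remaining W-vertices are
  -- isolated and therefore irrelevant for matchings.
  deleteVertices : Graph n → (Fin n → Bool) → Graph n
  deleteVertices G W x y = G x y ∧ not (W x) ∧ not (W y)

  degree : Graph n → Fin n → ℕ
  degree G v = sum (map (λ x → if G v x then 1 else 0) (allFin n))

  HasMatching : Graph n → ℕ → Set
  HasMatching G m =
    Σ (Fin m → Fin n × Fin n) λ f →
      (∀ i → Adj G (proj₁ (f i)) (proj₂ (f i)) × proj₁ (f i) ≢ proj₂ (f i)) ×
      (∀ i j → i ≢ j →
         (proj₁ (f i) ≢ proj₁ (f j)) × (proj₁ (f i) ≢ proj₂ (f j)) × (proj₂ (f i) ≢ proj₂ (f j)))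

  MatchingNumber : Graph n → ℕ → Set
  MatchingNumber G m = HasMatching G m × (∀ j → m < j → ¬ HasMatching G j)

  Legal : ℕ → Graph n → Fin n → Fin n → Set
  Legal k G a b = a ≢ b × ¬ Adj G a b × ¬ HasMatching (addEdge G a b) k

  Saturated : ℕ → Graph n → Set
  Saturated k G = ∀ a b → ¬ Legal k G a b

  -- Max can force that the final graph satisfies P.
  --   MaxTurn k P G : Max is to move in position G;
  --   MiniTurn k P G : Mini is to move in position G.
  -- (Inductive = well-founded game trees, i.e. strategies in the finite game.)
  mutual
    data MaxTurn (k : ℕ) (P : Graph n → Set) (G : Graph n) : Set where
      maxEnd  : Saturated k G → P G → MaxTurn k P G
      maxPlay : (a b : Fin n) → Legal k G a b → MiniTurn k P (addEdge G a b) → MaxTurn k P G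

    data MiniTurn (k : ℕ) (P : Graph n → Set) (G : Graph n) : Set where
      miniTurn : (Saturated k G → P G) →
                 (∀ a b → Legal k G a b → MaxTurn k P (addEdge G a b)) →
                 MiniTurn k P G

  EveryWHasUNeighbour : (Fin n → Bool) → Graph n → Set
  EveryWHasUNeighbour W G = ∀ w → W w ≡ true → ∃ λ x → W x ≡ false × Adj G w x

module Submission where

-- Max maintains that, whenever Mini is to move, two vertices of W are pendant at u
-- (or the goal already holds).  While some w ∈ W is pendant at u, adding an edge zu
-- never creates a k-matching: trade zu for uw.  No edge inside W can ever be added,
-- since ν(G ∖ W) = k − 1; so a vertex z ∈ W without neighbour in U is isolated, and
-- Max's move zu makes it a second pendant at u.  A move of Mini destroys at most one
-- of two pendants, and at the end of the game a pendant shows that no z ∈ W lacks a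
-- neighbour in U, as zu would still be legal.

open import Defs
open import Data.Nat using (ℕ; zero; suc; _≤_; _<_; _+_; _∸_; z≤n; s≤s)
open import Data.Nat.Properties using (≤-trans; +-mono-≤; +-monoʳ-≤; +-comm; +-mono-<-≤; +-mono-≤-<; m≤m+n; m≤n+m; n<1+n)
open import Data.Nat.Induction using (<-wellFounded)
open import Data.Fin using (Fin; zero; suc; _≟_)
open import Data.Fin.Properties using (any?; all?; ¬∀⟶∃¬; suc-injective)
open import Data.Bool using (Bool; true; false; T; _∧_; _∨_; if_then_else_)
open import Data.Bool.Properties using (T-∧; T-∨; T-≡; T-not-≡; ⇔→≡; ¬-not) renaming (_≟_ to _≟ᵇ_)
open import Data.List using (_∷_; map)
open import Data.List.Membership.Propositional using (_∈_)
open import Data.List.Membership.Propositional.Properties using (∈-allFin)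
open import Data.List.Relation.Unary.Any using (here; there)
open import Data.Nat.ListAction using (sum)
open import Data.Product using (∃; ∃₂; _×_; _,_; proj₁; proj₂; map₁)
open import Data.Product.Function.NonDependent.Propositional using (_×-⇔_)
open import Data.Sum using (_⊎_; inj₁; inj₂; [_,_]′)
open import Data.Sum.Function.Propositional using (_⊎-⇔_)
open import Data.Vec.Functional using (updateAt)
import Data.Vec.Functional as Vector
open import Data.Vec.Functional.Properties using (updateAt-updates; updateAt-minimal)
open import Function using (_∘_; const; _⇔_; mk⇔; Equivalence)
open import Function.Construct.Composition using (_⇔-∘_)
open import Function.Construct.Identity using (⇔-id)
open import Function.Construct.Symmetry using (⇔-sym)
open import Induction.WellFounded using (Acc; acc)
open import Relation.Nullary using (¬_; Dec; yes; no; contradiction)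
open import Relation.Nullary.Decidable using (⌊_⌋; toWitness; fromWitness; T?; ¬?; _×-dec_; decidable-stable)
import Relation.Nullary.Decidable as Dec
open import Relation.Binary.PropositionalEquality using (_≡_; _≢_; refl; sym; trans; cong; subst; subst₂)

open Equivalence using (to; from)

T-injective : ∀ {p q} → T p ⇔ T q → p ≡ q
T-injective e = ⇔→≡ (T-≡ ⇔-∘ (e ⇔-∘ ⇔-sym T-≡))

¬T⇒≡false : ∀ {b} → ¬ T b → b ≡ false
¬T⇒≡false ¬b = ¬-not (¬b ∘ from T-≡)

indicator-≢ : ∀ {A : Set} (S : A → Bool) {x y} → S x ≡ true → S y ≡ false → x ≢ y
indicator-≢ S Sx Sy x≡y with trans (sym Sx) (trans (cong S x≡y) Sy)
... | ()

module _ {A : Set} (f : A → ℕ) where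

  sum-map-≥ : ∀ {x xs} → x ∈ xs → f x ≤ sum (map f xs)
  sum-map-≥ {xs = y ∷ ys} (here refl) = m≤m+n (f y) (sum (map f ys))
  sum-map-≥ {xs = y ∷ ys} (there x∈ys) = ≤-trans (sum-map-≥ x∈ys) (m≤n+m _ (f y))

  sum-map-≥-pair : ∀ {x y xs} → x ∈ xs → y ∈ xs → x ≢ y → f x + f y ≤ sum (map f xs)
  sum-map-≥-pair (here refl) (here refl) x≢y = contradiction refl x≢y
  sum-map-≥-pair (here refl) (there y∈xs) _ = +-monoʳ-≤ _ (sum-map-≥ y∈xs)
  sum-map-≥-pair {x} {xs = y ∷ ys} (there x∈ys) (here refl) _ =
    subst (_≤ f y + sum (map f ys)) (+-comm (f y) (f x)) (+-monoʳ-≤ (f y) (sum-map-≥ x∈ys))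
  sum-map-≥-pair {xs = z ∷ zs} (there x∈zs) (there y∈zs) x≢y =
    ≤-trans (sum-map-≥-pair x∈zs y∈zs x≢y) (m≤n+m _ (f z))

∑ : ∀ {m} → (Fin m → ℕ) → ℕ
∑ {zero} f = 0
∑ {suc m} f = f zero + ∑ (f ∘ suc)

∑-mono-≤ : ∀ {m} {f g : Fin m → ℕ} → (∀ i → f i ≤ g i) → ∑ f ≤ ∑ g
∑-mono-≤ {zero} f≤g = z≤n
∑-mono-≤ {suc m} f≤g = +-mono-≤ (f≤g zero) (∑-mono-≤ (f≤g ∘ suc))

∑-mono-< : ∀ {m} {f g : Fin m → ℕ} → (∀ i → f i ≤ g i) → ∀ i → f i < g i → ∑ f < ∑ g
∑-mono-< f≤g zero fi<gi = +-mono-<-≤ fi<gi (∑-mono-≤ (f≤g ∘ suc))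
∑-mono-< f≤g (suc i) fi<gi = +-mono-≤-< (f≤g zero) (∑-mono-< (f≤g ∘ suc) i fi<gi)

module _ {n : ℕ} where

  T-≟ : {x y : Fin n} → T ⌊ x ≟ y ⌋ ⇔ x ≡ y
  T-≟ = mk⇔ toWitness fromWitness

  adj-addEdge⇔ : (G : Graph n) (a b : Fin n) {x y : Fin n} →
    Adj (addEdge G a b) x y ⇔ (Adj G x y ⊎ (x ≡ a × y ≡ b) ⊎ (x ≡ b × y ≡ a))
  adj-addEdge⇔ G a b = (⇔-id _ ⊎-⇔ ((bothEqual ⊎-⇔ bothEqual) ⇔-∘ T-∨)) ⇔-∘ T-∨
    where
    bothEqual : {p q r s : Fin n} → T (⌊ p ≟ q ⌋ ∧ ⌊ r ≟ s ⌋) ⇔ (p ≡ q × r ≡ s)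
    bothEqual = (T-≟ ×-⇔ T-≟) ⇔-∘ T-∧

  adj-deleteVertices⇔ : (G : Graph n) (S : Fin n → Bool) {x y : Fin n} →
    Adj (deleteVertices G S) x y ⇔ (Adj G x y × S x ≡ false × S y ≡ false)
  adj-deleteVertices⇔ G S = (⇔-id _ ×-⇔ ((T-not-≡ ×-⇔ T-not-≡) ⇔-∘ T-∧)) ⇔-∘ T-∧

  addEdge-⊇ : (G : Graph n) (a b : Fin n) {x y : Fin n} → Adj G x y → Adj (addEdge G a b) x y
  addEdge-⊇ G a b = from (adj-addEdge⇔ G a b) ∘ inj₁

  addEdge-adj : (G : Graph n) (a b : Fin n) → Adj (addEdge G a b) a b
  addEdge-adj G a b = from (adj-addEdge⇔ G a b) (inj₂ (inj₁ (refl , refl)))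

  addEdge-adj′ : (G : Graph n) (a b : Fin n) → Adj (addEdge G a b) b a
  addEdge-adj′ G a b = from (adj-addEdge⇔ G a b) (inj₂ (inj₂ (refl , refl)))

  adj-sym : {G : Graph n} → IsSimple G → {x y : Fin n} → Adj G x y → Adj G y x
  adj-sym (symmetric , _) {x} {y} = subst T (symmetric x y)

  adj⇒≢ : {G : Graph n} → IsSimple G → {x y : Fin n} → Adj G x y → x ≢ y
  adj⇒≢ (_ , loopless) {x} Gxx refl = subst T (loopless x) Gxx

  IsSimple-addEdge : {G : Graph n} {a b : Fin n} → IsSimple G → a ≢ b → IsSimple (addEdge G a b)
  IsSimple-addEdge {G} {a} {b} simple a≢b =
      (λ x y → T-injective (mk⇔ flipped flipped))
    , (λ x → ¬T⇒≡false (noLoop ∘ to (adj-addEdge⇔ G a b)))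
    where
    flipped : ∀ {x y} → Adj (addEdge G a b) x y → Adj (addEdge G a b) y x
    flipped Gxy with to (adj-addEdge⇔ G a b) Gxy
    ... | inj₁ Gxy′ = addEdge-⊇ G a b (adj-sym simple Gxy′)
    ... | inj₂ (inj₁ (refl , refl)) = addEdge-adj′ G a b
    ... | inj₂ (inj₂ (refl , refl)) = addEdge-adj G a b
    noLoop : ∀ {x} → ¬ (Adj G x x ⊎ (x ≡ a × x ≡ b) ⊎ (x ≡ b × x ≡ a))
    noLoop (inj₁ Gxx) = adj⇒≢ simple Gxx refl
    noLoop (inj₂ (inj₁ (refl , refl))) = a≢b refl
    noLoop (inj₂ (inj₂ (refl , refl))) = a≢b refl

  Pendant : Graph n → Fin n → Fin n → Set
  Pendant G u w = Adj G u w × (∀ x → Adj G w x → x ≡ u)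

  pendant-addEdge : (G : Graph n) {u w : Fin n} (a b : Fin n) → Pendant G u w → w ≢ a → w ≢ b →
                    Pendant (addEdge G a b) u w
  pendant-addEdge G {u} {w} a b (u~w , onlyU) w≢a w≢b =
    addEdge-⊇ G a b u~w , λ x → neighbour x ∘ to (adj-addEdge⇔ G a b)
    where
    neighbour : ∀ x → Adj G w x ⊎ (w ≡ a × x ≡ b) ⊎ (w ≡ b × x ≡ a) → x ≡ u
    neighbour x (inj₁ w~x) = onlyU x w~x
    neighbour x (inj₂ (inj₁ (w≡a , _))) = contradiction w≡a w≢a
    neighbour x (inj₂ (inj₂ (w≡b , _))) = contradiction w≡b w≢b

  isolated-addEdge-pendant : (G : Graph n) {z : Fin n} (u : Fin n) → (∀ x → ¬ Adj G z x) →
                             Pendant (addEdge G z u) u z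
  isolated-addEdge-pendant G {z} u isolated =
    addEdge-adj′ G z u , λ x → neighbour x ∘ to (adj-addEdge⇔ G z u)
    where
    neighbour : ∀ x → Adj G z x ⊎ (z ≡ z × x ≡ u) ⊎ (z ≡ u × x ≡ z) → x ≡ u
    neighbour x (inj₁ z~x) = contradiction z~x (isolated x)
    neighbour x (inj₂ (inj₁ (_ , x≡u))) = x≡u
    neighbour x (inj₂ (inj₂ (z≡u , refl))) = z≡u

  degree≡1⇒pendant : {G : Graph n} {u w : Fin n} → IsSimple G → degree G w ≡ 1 → Adj G u w → Pendant G u w
  degree≡1⇒pendant {G} {u} {w} simple deg≡1 u~w = u~w , onlyU
    where
    indicator : Fin n → ℕ
    indicator x = if G w x then 1 else 0
    indicator-T : ∀ {x} → Adj G w x → 1 ≤ indicator x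
    indicator-T {x} w~x with G w x
    ... | true = s≤s z≤n
    onlyU : ∀ x → Adj G w x → x ≡ u
    onlyU x w~x with x ≟ u
    ... | yes x≡u = x≡u
    ... | no x≢u = contradiction (subst (2 ≤_) deg≡1 twoNeighbours) λ { (s≤s ()) }
      where
      twoNeighbours : 2 ≤ degree G w
      twoNeighbours = ≤-trans (+-mono-≤ (indicator-T w~x) (indicator-T (adj-sym simple u~w)))
                              (sum-map-≥-pair indicator (∈-allFin x) (∈-allFin u) x≢u)

  _∉ₑ_ : Fin n → Fin n × Fin n → Set
  v ∉ₑ e = v ≢ proj₁ e × v ≢ proj₂ e

  Disjoint : Fin n × Fin n → Fin n × Fin n → Set
  Disjoint e e′ = proj₁ e ∉ₑ e′ × proj₂ e ∉ₑ e′

  IsEdge : Graph n → Fin n × Fin n → Set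
  IsEdge G e = Adj G (proj₁ e) (proj₂ e) × proj₁ e ≢ proj₂ e

  Disjoint-sym : {e e′ : Fin n × Fin n} → Disjoint e e′ → Disjoint e′ e
  Disjoint-sym ((p₁ , p₂) , (q₁ , q₂)) = (p₁ ∘ sym , q₁ ∘ sym) , (p₂ ∘ sym , q₂ ∘ sym)

  -- ¬ v ∉ₑ e is the constructive reading of "v is an endpoint of e".
  endpoint-∉ₑ : {v : Fin n} {e e′ : Fin n × Fin n} → ¬ v ∉ₑ e → Disjoint e e′ → v ∉ₑ e′
  endpoint-∉ₑ v∈e disjoint with Disjoint-sym disjoint
  ... | (p , q) = (λ { refl → v∈e p }) , (λ { refl → v∈e q })

  Disjointness : {m : ℕ} → (Fin m → Fin n × Fin n) → Set
  Disjointness f = ∀ i j → i ≢ j → Disjoint (f i) (f j)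

  mkMatching : (G : Graph n) {m : ℕ} (f : Fin m → Fin n × Fin n) → (∀ i → IsEdge G (f i)) →
               Disjointness f → HasMatching G m
  mkMatching G f edges disjoint =
    f , edges , λ i j i≢j → let ((p , q) , (_ , r)) = disjoint i j i≢j in p , q , r

  matching-disjoint : {m : ℕ} {f : Fin m → Fin n × Fin n} →
    (∀ i j → i ≢ j → (proj₁ (f i) ≢ proj₁ (f j)) × (proj₁ (f i) ≢ proj₂ (f j)) × (proj₂ (f i) ≢ proj₂ (f j))) →
    Disjointness f
  matching-disjoint D i j i≢j with D i j i≢j | D j i (i≢j ∘ sym)
  ... | (p , q , r) | (_ , q′ , _) = (p , q) , (q′ ∘ sym , r)

  hasMatching-mono : {G H : Graph n} {m : ℕ} → (∀ {x y} → Adj G x y → Adj H x y) → HasMatching G m → HasMatching H m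
  hasMatching-mono G⊆H (f , edges , D) = f , (λ i → G⊆H (proj₁ (edges i)) , proj₂ (edges i)) , D

  hasMatching-extend : (G : Graph n) (S : Fin n → Bool) {m : ℕ} {a b : Fin n} →
    HasMatching (deleteVertices G S) m → IsEdge G (a , b) → S a ≡ true → S b ≡ true → HasMatching G (suc m)
  hasMatching-extend G S {a = a} {b} (f , fEdges , D) ab Sa Sb = mkMatching G ((a , b) Vector.∷ f) edges disjoint
    where
    kept : ∀ i → Adj G (proj₁ (f i)) (proj₂ (f i)) × S (proj₁ (f i)) ≡ false × S (proj₂ (f i)) ≡ false
    kept i = to (adj-deleteVertices⇔ G S) (proj₁ (fEdges i))
    avoids : ∀ {v} → S v ≡ true → ∀ i → v ∉ₑ f i
    avoids Sv i = indicator-≢ S Sv (proj₁ (proj₂ (kept i))) , indicator-≢ S Sv (proj₂ (proj₂ (kept i)))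
    edges : ∀ i → IsEdge G (((a , b) Vector.∷ f) i)
    edges zero = ab
    edges (suc i) = proj₁ (kept i) , proj₂ (fEdges i)
    disjoint : Disjointness ((a , b) Vector.∷ f)
    disjoint zero zero 0≢0 = contradiction refl 0≢0
    disjoint zero (suc j) _ = avoids Sa j , avoids Sb j
    disjoint (suc i) zero _ = Disjoint-sym (avoids Sa i , avoids Sb i)
    disjoint (suc i) (suc j) i≢j = matching-disjoint D i j (i≢j ∘ cong suc)

  endpoints : Fin n → Fin n → Fin n → Bool
  endpoints a b x = ⌊ x ≟ a ⌋ ∨ ⌊ x ≟ b ⌋

  T-endpoints : (a b : Fin n) {x : Fin n} → T (endpoints a b x) ⇔ (x ≡ a ⊎ x ≡ b)
  T-endpoints a b = (T-≟ ⊎-⇔ T-≟) ⇔-∘ T-∨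

  hasMatching-split : {G : Graph n} {m : ℕ} → HasMatching G (suc m) →
    ∃₂ λ a b → IsEdge G (a , b) × HasMatching (deleteVertices G (endpoints a b)) m
  hasMatching-split {G} (f , fEdges , D) =
    a , b , fEdges zero , mkMatching (deleteVertices G (endpoints a b)) (f ∘ suc) edges disjoint
    where
    a b : Fin n
    a = proj₁ (f zero)
    b = proj₂ (f zero)
    outside : ∀ {x} → x ∉ₑ (a , b) → endpoints a b x ≡ false
    outside (x≢a , x≢b) = ¬T⇒≡false λ x∈ab → [ x≢a , x≢b ]′ (to (T-endpoints a b) x∈ab)
    edges : ∀ i → IsEdge (deleteVertices G (endpoints a b)) (f (suc i))
    edges i with fEdges (suc i) | matching-disjoint D (suc i) zero (λ ())
    ... | (fi∈G , proper) | (p , q) =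
          from (adj-deleteVertices⇔ G (endpoints a b)) (fi∈G , outside p , outside q) , proper
    disjoint : Disjointness (f ∘ suc)
    disjoint i j i≢j = matching-disjoint D (suc i) (suc j) (i≢j ∘ suc-injective)

  hasMatching-suc⇔ : {G : Graph n} {m : ℕ} →
    (∃₂ λ a b → IsEdge G (a , b) × HasMatching (deleteVertices G (endpoints a b)) m) ⇔ HasMatching G (suc m)
  hasMatching-suc⇔ {G} {m} = mk⇔ extend hasMatching-split
    where
    extend : (∃₂ λ a b → IsEdge G (a , b) × HasMatching (deleteVertices G (endpoints a b)) m) → HasMatching G (suc m)
    extend (a , b , ab , M) = hasMatching-extend G (endpoints a b) M ab (to T-≡ (from (T-endpoints a b) (inj₁ refl)))
                                                                      (to T-≡ (from (T-endpoints a b) (inj₂ refl)))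

  hasMatching? : (m : ℕ) (G : Graph n) → Dec (HasMatching G m)
  hasMatching? zero G = yes ((λ ()) , (λ ()) , (λ ()))
  hasMatching? (suc m) G = Dec.map hasMatching-suc⇔
    (any? λ a → any? λ b → (T? (G a b) ×-dec ¬? (a ≟ b)) ×-dec hasMatching? m (deleteVertices G (endpoints a b)))

  hasMatching-replace : (G : Graph n) {m : ℕ} (f : Fin m → Fin n × Fin n) → Disjointness f →
    (i : Fin m) {e : Fin n × Fin n} → IsEdge G e → (∀ j → j ≢ i → IsEdge G (f j) × Disjoint e (f j)) →
    HasMatching G m
  hasMatching-replace G {m} f disjoint i {e} e∈G others = mkMatching G g edges disjoint′
    where
    g : Fin m → Fin n × Fin n
    g = updateAt f i (const e)
    at-i : g i ≡ e
    at-i = updateAt-updates i f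
    elsewhere : ∀ {j} → j ≢ i → g j ≡ f j
    elsewhere {j} = updateAt-minimal j i f
    edges : ∀ j → IsEdge G (g j)
    edges j with j ≟ i
    ... | yes refl = subst (IsEdge G) (sym at-i) e∈G
    ... | no j≢i = subst (IsEdge G) (sym (elsewhere j≢i)) (proj₁ (others j j≢i))
    disjoint′ : Disjointness g
    disjoint′ j j′ j≢j′ with j ≟ i | j′ ≟ i
    ... | yes refl | yes refl = contradiction refl j≢j′
    ... | yes refl | no j′≢i = subst₂ Disjoint (sym at-i) (sym (elsewhere j′≢i)) (proj₂ (others j′ j′≢i))
    ... | no j≢i | yes refl = subst₂ Disjoint (sym (elsewhere j≢i)) (sym at-i) (Disjoint-sym (proj₂ (others j j≢i)))
    ... | no j≢i | no j′≢i = subst₂ Disjoint (sym (elsewhere j≢i)) (sym (elsewhere j′≢i)) (disjoint j j′ j≢j′)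

  -- The other edges of a matching using the new edge avoid u, hence also w.
  hasMatching-addEdge-at-support : {G : Graph n} {u w : Fin n} (z : Fin n) {m : ℕ} → IsSimple G → Pendant G u w →
    HasMatching (addEdge G z u) m → HasMatching G m
  hasMatching-addEdge-at-support {G} {u} {w} z simple (u~w , onlyU) (f , fEdges , D)
    with all? (λ i → T? (G (proj₁ (f i)) (proj₂ (f i))))
  ... | yes allOld = f , (λ i → allOld i , proj₂ (fEdges i)) , D
  ... | no ¬allOld with ¬∀⟶∃¬ _ _ (λ i → T? (G (proj₁ (f i)) (proj₂ (f i)))) ¬allOld
  ...   | (i , new) = hasMatching-replace G f (matching-disjoint D) i (u~w , adj⇒≢ simple u~w) others
    where
    u∈fi : ¬ u ∉ₑ f i
    u∈fi (u≢x , u≢y) with to (adj-addEdge⇔ G z u) (proj₁ (fEdges i))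
    ... | inj₁ old = new old
    ... | inj₂ (inj₁ (_ , y≡u)) = u≢y (sym y≡u)
    ... | inj₂ (inj₂ (x≡u , _)) = u≢x (sym x≡u)
    others : ∀ j → j ≢ i → IsEdge G (f j) × Disjoint (u , w) (f j)
    others j j≢i = (old , proj₂ (fEdges j)) , u∉fj , w∉fj
      where
      u∉fj : u ∉ₑ f j
      u∉fj = endpoint-∉ₑ u∈fi (matching-disjoint D i j (j≢i ∘ sym))
      old : Adj G (proj₁ (f j)) (proj₂ (f j))
      old with to (adj-addEdge⇔ G z u) (proj₁ (fEdges j))
      ... | inj₁ old = old
      ... | inj₂ (inj₁ (_ , y≡u)) = contradiction (sym y≡u) (proj₂ u∉fj)
      ... | inj₂ (inj₂ (x≡u , _)) = contradiction (sym x≡u) (proj₁ u∉fj)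
      w∉fj : w ∉ₑ f j
      w∉fj = (λ w≡x → proj₂ u∉fj (sym (onlyU _ (subst (λ t → Adj G t _) (sym w≡x) old))))
           , (λ w≡y → proj₁ u∉fj (sym (onlyU _ (subst (λ t → Adj G t _) (sym w≡y) (adj-sym simple old)))))

  legal? : (k : ℕ) (G : Graph n) (a b : Fin n) → Dec (Legal k G a b)
  legal? k G a b = ¬? (a ≟ b) ×-dec ¬? (T? (G a b)) ×-dec ¬? (hasMatching? k (addEdge G a b))

  nonEdges : Graph n → ℕ
  nonEdges G = ∑ λ x → ∑ λ y → if G x y then 0 else 1

  nonEdges-addEdge : (G : Graph n) {a b : Fin n} → ¬ Adj G a b → nonEdges (addEdge G a b) < nonEdges G
  nonEdges-addEdge G {a} {b} ¬ab =
    ∑-mono-< (λ x → ∑-mono-≤ (entry x)) a (∑-mono-< (entry a) b (strict ¬ab (addEdge-adj G a b)))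
    where
    anti : ∀ {p q} → (T p → T q) → (if q then 0 else 1) ≤ (if p then 0 else 1)
    anti {false} {false} _ = s≤s z≤n
    anti {false} {true} _ = z≤n
    anti {true} {false} p⇒q = contradiction (p⇒q _) λ ()
    anti {true} {true} _ = z≤n
    strict : ∀ {p q} → ¬ T p → T q → (if q then 0 else 1) < (if p then 0 else 1)
    strict {false} {true} _ _ = s≤s z≤n
    strict {true} ¬p _ = contradiction _ ¬p
    entry : ∀ x y → (if addEdge G a b x y then 0 else 1) ≤ (if G x y then 0 else 1)
    entry x y = anti (addEdge-⊇ G a b)

module StrategyFromInvariant {n : ℕ} (k : ℕ) (P : Graph n → Set) (MaxPos MiniPos : Graph n → Set)
  (miniPos-saturated : ∀ {G} → MiniPos G → Saturated k G → P G)
  (miniPos-move : ∀ {G a b} → MiniPos G → Legal k G a b → MaxPos (addEdge G a b))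
  (maxPos-move : ∀ {G} → MaxPos G → (Saturated k G × P G) ⊎ (∃₂ λ a b → Legal k G a b × MiniPos (addEdge G a b)))
  where

  private
    mutual
      maxWins : ∀ {G} → Acc _<_ (nonEdges G) → MaxPos G → MaxTurn k P G
      maxWins {G} (acc smaller) pos with maxPos-move pos
      ... | inj₁ (saturated , pG) = maxEnd saturated pG
      ... | inj₂ (a , b , legal , pos′) =
            maxPlay a b legal (miniWins (smaller (nonEdges-addEdge G (proj₁ (proj₂ legal)))) pos′)

      miniWins : ∀ {G} → Acc _<_ (nonEdges G) → MiniPos G → MiniTurn k P G
      miniWins {G} (acc smaller) pos = miniTurn (miniPos-saturated pos) λ a b legal →
        maxWins (smaller (nonEdges-addEdge G (proj₁ (proj₂ legal)))) (miniPos-move pos legal)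

  miniTurn-from-invariant : ∀ {G} → MiniPos G → MiniTurn k P G
  miniTurn-from-invariant = miniWins (<-wellFounded _)

-- Max's strategy; k is the paper's k − 1.

module LeafStrategy {n : ℕ} (k : ℕ) (W : Fin n → Bool) (u : Fin n) (u∉W : W u ≡ false) where

  HasUNeighbour : Graph n → Fin n → Set
  HasUNeighbour G z = ∃ λ x → W x ≡ false × Adj G z x

  Valid : Graph n → Set
  Valid G = IsSimple G × ¬ HasMatching G (suc k) × HasMatching (deleteVertices G W) k

  Leaf : Graph n → Fin n → Set
  Leaf G w = W w ≡ true × Pendant G u w

  MaxPos : Graph n → Set
  MaxPos G = Valid G × (EveryWHasUNeighbour W G ⊎ ∃ (Leaf G))

  MiniPos : Graph n → Set
  MiniPos G = Valid G × (EveryWHasUNeighbour W G ⊎ ∃₂ λ w w′ → w ≢ w′ × Leaf G w × Leaf G w′)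

  valid-addEdge : ∀ {G a b} → Valid G → Legal (suc k) G a b → Valid (addEdge G a b)
  valid-addEdge {G} {a} {b} (simple , _ , M) (a≢b , _ , noMatching) =
    IsSimple-addEdge simple a≢b , noMatching , hasMatching-mono {G = deleteVertices G W} kept M
    where
    kept : ∀ {x y} → Adj (deleteVertices G W) x y → Adj (deleteVertices (addEdge G a b) W) x y
    kept = from (adj-deleteVertices⇔ (addEdge G a b) W) ∘ map₁ (addEdge-⊇ G a b) ∘ to (adj-deleteVertices⇔ G W)

  everyWHasUNeighbour-addEdge : ∀ {G} a b → EveryWHasUNeighbour W G → EveryWHasUNeighbour W (addEdge G a b)
  everyWHasUNeighbour-addEdge {G} a b every w w∈W with every w w∈W
  ... | (x , x∉W , w~x) = x , x∉W , addEdge-⊇ G a b w~x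

  W-independent : ∀ {G x y} → Valid G → W x ≡ true → W y ≡ true → ¬ Adj G x y
  W-independent {G} (simple , noMatching , M) x∈W y∈W x~y =
    noMatching (hasMatching-extend G W M (x~y , adj⇒≢ simple x~y) x∈W y∈W)

  hasUNeighbour? : ∀ G z → Dec (HasUNeighbour G z)
  hasUNeighbour? G z = any? λ x → (W x ≟ᵇ false) ×-dec T? (G z x)

  everyWHasUNeighbour⊎unattached : ∀ G → EveryWHasUNeighbour W G ⊎ ∃ λ z → W z ≡ true × ¬ HasUNeighbour G z
  everyWHasUNeighbour⊎unattached G with any? (λ z → (W z ≟ᵇ true) ×-dec ¬? (hasUNeighbour? G z))
  ... | yes unattached = inj₂ unattached
  ... | no none = inj₁ λ z z∈W → decidable-stable (hasUNeighbour? G z) (λ lacks → none (z , z∈W , lacks))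

  attach-legal : ∀ {G w z} → Valid G → Leaf G w → W z ≡ true → ¬ HasUNeighbour G z → Legal (suc k) G z u
  attach-legal {z = z} (simple , noMatching , _) (_ , pendant) z∈W lacks =
      indicator-≢ W z∈W u∉W
    , (λ z~u → lacks (u , u∉W , z~u))
    , noMatching ∘ hasMatching-addEdge-at-support z simple pendant

  attach-leaf : ∀ {G z} → Valid G → W z ≡ true → ¬ HasUNeighbour G z → Leaf (addEdge G z u) z
  attach-leaf {G} {z} valid z∈W lacks = z∈W , isolated-addEdge-pendant G u isolated
    where
    isolated : ∀ x → ¬ Adj G z x
    isolated x z~x with W x in Wx
    ... | true = W-independent valid z∈W Wx z~x
    ... | false = lacks (x , Wx , z~x)

  leaf-saturated : ∀ {G w} → Valid G → Leaf G w → Saturated (suc k) G → EveryWHasUNeighbour W G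
  leaf-saturated {G} valid leaf saturated z z∈W =
    decidable-stable (hasUNeighbour? G z) λ lacks → saturated z u (attach-legal valid leaf z∈W lacks)

  -- Mini can touch both leaves only by joining them, which is an edge inside W.
  leaf-survives : ∀ {G a b w w′} → Valid (addEdge G a b) → w ≢ w′ → Leaf G w → Leaf G w′ → ∃ (Leaf (addEdge G a b))
  leaf-survives {G} {a} {b} {w} {w′} valid′ w≢w′ (w∈W , pw) (w′∈W , pw′) with w ≟ a | w ≟ b | w′ ≟ a | w′ ≟ b
  ... | no w≢a | no w≢b | _ | _ = w , w∈W , pendant-addEdge G a b pw w≢a w≢b
  ... | _ | _ | no w′≢a | no w′≢b = w′ , w′∈W , pendant-addEdge G a b pw′ w′≢a w′≢b
  ... | yes refl | _ | yes refl | _ = contradiction refl w≢w′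
  ... | _ | yes refl | _ | yes refl = contradiction refl w≢w′
  ... | yes refl | _ | _ | yes refl = contradiction (addEdge-adj G a b) (W-independent valid′ w∈W w′∈W)
  ... | _ | yes refl | yes refl | _ = contradiction (addEdge-adj G a b) (W-independent valid′ w′∈W w∈W)

  MaxOutcome : Graph n → Set
  MaxOutcome G = (Saturated (suc k) G × EveryWHasUNeighbour W G) ⊎
                 (∃₂ λ a b → Legal (suc k) G a b × MiniPos (addEdge G a b))

  keep-playing : ∀ {G} → Valid G → EveryWHasUNeighbour W G → MaxOutcome G
  keep-playing {G} valid every with any? (λ a → any? (legal? (suc k) G a))
  ... | yes (a , b , legal) =
        inj₂ (a , b , legal , valid-addEdge valid legal , inj₁ (everyWHasUNeighbour-addEdge a b every))
  ... | no none = inj₁ ((λ a b legal → none (a , b , legal)) , every)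

  attach : ∀ {G w z} → Valid G → Leaf G w → W z ≡ true → ¬ HasUNeighbour G z → MaxOutcome G
  attach {G} {w} {z} valid@(simple , _) leaf@(w∈W , pendant) z∈W lacks =
    inj₂ (z , u , legal , valid-addEdge valid legal , inj₂ (z , w , z≢w , attach-leaf valid z∈W lacks , w∈W , pendant′))
    where
    legal : Legal (suc k) G z u
    legal = attach-legal valid leaf z∈W lacks
    z≢w : z ≢ w
    z≢w refl = lacks (u , u∉W , adj-sym simple (proj₁ pendant))
    pendant′ : Pendant (addEdge G z u) u w
    pendant′ = pendant-addEdge G z u pendant (z≢w ∘ sym) (indicator-≢ W w∈W u∉W)

  maxPos-move : ∀ {G} → MaxPos G → MaxOutcome G
  maxPos-move {G} (valid , pos) with everyWHasUNeighbour⊎unattached G | pos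
  ... | inj₁ every | _ = keep-playing valid every
  ... | inj₂ (z , z∈W , lacks) | inj₁ every = contradiction (every z z∈W) lacks
  ... | inj₂ (z , z∈W , lacks) | inj₂ (w , leaf) = attach valid leaf z∈W lacks

  miniPos-move : ∀ {G a b} → MiniPos G → Legal (suc k) G a b → MaxPos (addEdge G a b)
  miniPos-move {a = a} {b} (valid , inj₁ every) legal =
    valid-addEdge valid legal , inj₁ (everyWHasUNeighbour-addEdge a b every)
  miniPos-move {G} {a} {b} (valid , inj₂ (w , w′ , w≢w′ , leaf , leaf′)) legal =
    valid′ , inj₂ (leaf-survives valid′ w≢w′ leaf leaf′)
    where
    valid′ : Valid (addEdge G a b)
    valid′ = valid-addEdge valid legal

  miniPos-saturated : ∀ {G} → MiniPos G → Saturated (suc k) G → EveryWHasUNeighbour W G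
  miniPos-saturated (_ , inj₁ every) _ = every
  miniPos-saturated (valid , inj₂ (_ , _ , _ , leaf , _)) saturated = leaf-saturated valid leaf saturated

  open StrategyFromInvariant (suc k) (EveryWHasUNeighbour W) MaxPos MiniPos
         miniPos-saturated miniPos-move maxPos-move public

lemma4p6 : (k n : ℕ) → 2 ≤ k →
    (G₀ : Graph n) → IsSimple G₀ →
    (W : Fin n → Bool) →
    MatchingNumber G₀ (k ∸ 1) →
    MatchingNumber (deleteVertices G₀ W) (k ∸ 1) →
    (w₁ w₂ u : Fin n) → w₁ ≢ w₂ →
    W w₁ ≡ true → W w₂ ≡ true → W u ≡ false →
    degree G₀ w₁ ≡ 1 → degree G₀ w₂ ≡ 1 →
    Adj G₀ u w₁ → Adj G₀ u w₂ →
    MiniTurn k (EveryWHasUNeighbour W) G₀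
lemma4p6 (suc k) n _ G₀ simple W (_ , maximum) (M , _) w₁ w₂ u w₁≢w₂ w₁∈W w₂∈W u∉W deg₁ deg₂ u~w₁ u~w₂ =
  miniTurn-from-invariant
    ( (simple , maximum (suc k) (n<1+n k) , M)
    , inj₂ (w₁ , w₂ , w₁≢w₂ , (w₁∈W , degree≡1⇒pendant simple deg₁ u~w₁) , (w₂∈W , degree≡1⇒pendant simple deg₂ u~w₂)))
  where open LeafStrategy k W u u∉W
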